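{- Let $2\leq \delta\leq \Delta$ be integers and let $G=K_{\Delta,\delta}$ be the complete bipartite graph with parts of sizes $\Delta$ and $\delta$. Then $$\chi'_{\subset}(G) = \left\lceil\left(1+\frac{1}{\delta-1}\right)\Delta\right\rceil.$$
   Context: All graphs are simple and finite. For an edge colouring $c\colon E\to C$ of a graph $G=(V,E)$, the palette of a vertex $v$ is $S_c(v)=\{c(uv): u\in N(v)\}$. The colouring $c$ is inclusion-free if it is proper (adjacent edges receive distinct colours) and for every edge $uv\in E$ we have $S_c(u)\not\subseteq S_c(v)$ (and, since the edge is unordered, also $S_c(v)\not\subseteq S_c(u)$). Such a colouring exists iff $G$ has no vertex of degree one. The inclusion chromatic index $\chi'_{\subset}(G)$ is the least number of colours in an inclusion-free colouring of $G$. -}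

module Defs where

open import Data.Nat using (ℕ; zero; suc; _+_; _*_; _≤_)
open import Data.Nat.DivMod using (_/_)
open import Data.Fin using (Fin)
open import Data.Sum using (_⊎_; inj₁; inj₂)
open import Data.Product using (Σ; ∃; _×_; _,_)
open import Data.Unit using (⊤)
open import Data.Empty using (⊥)
open import Relation.Nullary using (¬_)
open import Relation.Binary.PropositionalEquality using (_≡_)

record SimpleGraph : Set₁ where
  field
    V      : Set
    Adj    : V → V → Set
    sym    : ∀ {u v} → Adj u v → Adj v u
    irrefl : ∀ {v} → ¬ Adj v v
open SimpleGraph public

-- An edge colouring with colour set C is represented as a function on ordered
-- vertex pairs which is symmetric on edges (values on non-edges are irrelevant).
record EdgeColouring (G : SimpleGraph) (C : Set) : Set where
  field
    col     : V G → V G → C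
    col-sym : ∀ {u v} → Adj G u v → col u v ≡ col v u
open EdgeColouring public

Palette : ∀ {G C} → EdgeColouring G C → V G → C → Set
Palette {G} c v x = Σ (V G) λ u → Adj G u v × (col c u v ≡ x)

_⊆P_ : ∀ {C : Set} → (C → Set) → (C → Set) → Set
P ⊆P Q = ∀ x → P x → Q x

Proper : ∀ {G C} → EdgeColouring G C → Set
Proper {G} c = ∀ u v w → Adj G u v → Adj G u w → col c u v ≡ col c u w → v ≡ w

InclusionFree : ∀ {G C} → EdgeColouring G C → Set
InclusionFree {G} c =
  Proper c ×
  (∀ u v → Adj G u v → ¬ (Palette c u ⊆P Palette c v) × ¬ (Palette c v ⊆P Palette c u))

InclusionColourable : SimpleGraph → ℕ → Set
InclusionColourable G k = Σ (EdgeColouring G (Fin k)) InclusionFree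

InclusionChromaticIndex : SimpleGraph → ℕ → Set
InclusionChromaticIndex G k =
  InclusionColourable G k × (∀ m → InclusionColourable G m → k ≤ m)

KAdj : ∀ {a b} → Fin a ⊎ Fin b → Fin a ⊎ Fin b → Set
KAdj (inj₁ _) (inj₁ _) = ⊥
KAdj (inj₁ _) (inj₂ _) = ⊤
KAdj (inj₂ _) (inj₁ _) = ⊤
KAdj (inj₂ _) (inj₂ _) = ⊥

KAdj-sym : ∀ {a b} {u v : Fin a ⊎ Fin b} → KAdj u v → KAdj v u
KAdj-sym {u = inj₁ _} {inj₂ _} t = t
KAdj-sym {u = inj₂ _} {inj₁ _} t = t

KAdj-irrefl : ∀ {a b} {v : Fin a ⊎ Fin b} → ¬ KAdj v v
KAdj-irrefl {v = inj₁ _} ()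
KAdj-irrefl {v = inj₂ _} ()

K : ℕ → ℕ → SimpleGraph
K a b = record { V = Fin a ⊎ Fin b ; Adj = KAdj ; sym = KAdj-sym ; irrefl = KAdj-irrefl }

-- ceiling division ⌈ a / b ⌉ for b ≥ 1 (0 when b = 0; never used then)
⌈_/_⌉ : ℕ → ℕ → ℕ
⌈ a / zero ⌉ = 0
⌈ a / suc b ⌉ = (a + b) / suc b

-- ⌈ (1 + 1/(δ-1)) Δ ⌉ = ⌈ δΔ / (δ-1) ⌉   (meaningful for δ ≥ 2)
bound : ℕ → ℕ → ℕ
bound Δ zero = 0
bound Δ (suc d) = ⌈ suc d * Δ / d ⌉

module Submission where

-- Write an edge colouring of K_{Δ,δ} as a Δ × δ matrix with injective rows and columns; row a
-- escapes column b if some colour of row a is absent from column b.  Inclusion-freeness is exactly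
-- "every row escapes every column": a row palette inside a column palette is excluded by the escape,
-- and a column palette (Δ ≥ δ colours) inside a row palette would leave no room for the escaping colour.
--
-- Lower bound: fix column 0.  The d = δ − 1 copies of its Δ colours, one per other column, together
-- with the escaping entries of the Δ rows (each labelled by its column) are δΔ distinct pairs
-- (column ≠ 0, colour), so δΔ ≤ (δ − 1)·m.
--
-- Upper bound: with k = ⌈δΔ/(δ − 1)⌉ colours, give entry (a, b) the colour offset a + b mod k,
-- where offset a = a + ⌊a/d⌋ skips every slot ≡ d (mod δ); as k = offset (Δ − 1) + 2, the top
-- slot k − 1 is unused too.  Then no δ consecutive slots below k are all used, so for all a, b
-- some j < δ makes offset a + j − b (mod k) a free slot, and then the colour of (a, j) does not
-- occur in column b.

open import Data.Empty using (⊥-elim)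
open import Data.Fin using (Fin; zero; suc; toℕ; fromℕ<) renaming (_≟_ to _≟ᶠ_)
open import Data.Fin.Properties
  using (toℕ-fromℕ<; toℕ<n; toℕ-injective; any?; ¬∀⟶∃¬; injective⇒≤; +↔⊎; *↔×)
open import Data.Nat using (ℕ; zero; suc; _+_; _*_; _∸_; _≤_; _<_; _<?_; z≤n; s≤s; s≤s⁻¹; NonZero)
open import Data.Nat.Divisibility using (divides-refl; ∣-refl)
open import Data.Nat.DivMod
open import Data.Nat.Properties
open import Data.Nat.Tactic.RingSolver using (solve-∀)
open import Data.Product using (_×_; _,_; ∃-syntax; proj₁; proj₂)
open import Data.Product.Properties using (,-injectiveˡ; ,-injectiveʳ)
open import Data.Sum using (_⊎_; inj₁; inj₂)
open import Data.Sum.Function.Propositional using (_⊎-↔_)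
open import Data.Sum.Properties using (inj₁-injective)
open import Data.Unit using (tt)
open import Function.Bundles using (_↣_; mk↣; Injection)
open import Function.Construct.Composition using (_↣-∘_)
open import Function.Definitions using (Injective)
open import Function.Properties.Inverse using (↔⇒↣; ↔-sym; ↔-refl)
open import Relation.Nullary using (¬_; yes; no)
open import Relation.Binary.PropositionalEquality
  using (_≡_; _≢_; refl; sym; trans; cong; cong₂; subst; module ≡-Reasoning)

open import Defs hiding (sym)

module _ {Δ δ m : ℕ} (c : EdgeColouring (K Δ δ) (Fin m)) where

  entry : Fin Δ → Fin δ → Fin m
  entry a b = col c (inj₁ a) (inj₂ b)

  Escapes : Fin Δ → Fin δ → Set
  Escapes a b = ∃[ b′ ] ¬ (∃[ a′ ] entry a′ b ≡ entry a b′)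

  entry∈row-palette : ∀ a b → Palette c (inj₁ a) (entry a b)
  entry∈row-palette a b = inj₂ b , tt , sym (col-sym c {inj₁ a} {inj₂ b} tt)

  entry∈column-palette : ∀ a b → Palette c (inj₂ b) (entry a b)
  entry∈column-palette a b = inj₁ a , tt , refl

  row-palette : ∀ {a x} → Palette c (inj₁ a) x → ∃[ b ] entry a b ≡ x
  row-palette {a} (inj₂ b , _ , eq) = b , trans (col-sym c {inj₁ a} {inj₂ b} tt) eq

  column-palette : ∀ {b x} → Palette c (inj₂ b) x → ∃[ a ] entry a b ≡ x
  column-palette (inj₁ a , _ , eq) = a , eq

  escapes : InclusionFree c → ∀ a b → Escapes a b
  escapes (_ , incl) a b =
    ¬∀⟶∃¬ δ (λ b′ → ∃[ a′ ] entry a′ b ≡ entry a b′)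
      (λ b′ → any? (λ a′ → entry a′ b ≟ᶠ entry a b′))
      (λ inColumn → proj₁ (incl (inj₁ a) (inj₂ b) tt) (row⊆column inColumn))
    where
    row⊆column : (∀ b′ → ∃[ a′ ] entry a′ b ≡ entry a b′) →
                 Palette c (inj₁ a) ⊆P Palette c (inj₂ b)
    row⊆column inColumn x p with row-palette p
    ... | b′ , refl with inColumn b′
    ...   | a′ , eq = subst (Palette c (inj₂ b)) eq (entry∈column-palette a′ b)

  module _ (proper : Proper c) where

    entry-injectiveˡ : ∀ b → Injective _≡_ _≡_ (λ a → entry a b)
    entry-injectiveˡ b {a₁} {a₂} eq = inj₁-injective (proper (inj₂ b) (inj₁ a₁) (inj₁ a₂) tt tt
      (trans (sym (col-sym c {inj₁ a₁} {inj₂ b} tt)) (trans eq (col-sym c {inj₁ a₂} {inj₂ b} tt))))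

    row⊈column : ∀ {a b} → Escapes a b → ¬ (Palette c (inj₁ a) ⊆P Palette c (inj₂ b))
    row⊈column {a} {b} (b′ , fresh) row⊆column =
      fresh (column-palette (row⊆column _ (entry∈row-palette a b′)))

    column⊈row : δ ≤ Δ → ∀ {a b} → Escapes a b → ¬ (Palette c (inj₂ b) ⊆P Palette c (inj₁ a))
    column⊈row δ≤Δ {a} {b} (b′ , fresh) column⊆row = <⇒≱ (s≤s δ≤Δ) (injective⇒≤ ψ-injective)
      where
      φ : Fin Δ → Fin δ
      φ a′ = proj₁ (row-palette (column⊆row _ (entry∈column-palette a′ b)))

      entry-φ : ∀ a′ → entry a (φ a′) ≡ entry a′ b
      entry-φ a′ = proj₂ (row-palette (column⊆row _ (entry∈column-palette a′ b)))

      ψ : Fin (suc Δ) → Fin δ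
      ψ zero = b′
      ψ (suc a′) = φ a′

      ψ-injective : Injective _≡_ _≡_ ψ
      ψ-injective {zero} {zero} _ = refl
      ψ-injective {zero} {suc a′} eq =
        ⊥-elim (fresh (a′ , trans (sym (entry-φ a′)) (cong (entry a) (sym eq))))
      ψ-injective {suc a′} {zero} eq =
        ⊥-elim (fresh (a′ , trans (sym (entry-φ a′)) (cong (entry a) eq)))
      ψ-injective {suc a₁} {suc a₂} eq =
        cong suc (entry-injectiveˡ b (trans (sym (entry-φ a₁)) (trans (cong (entry a) eq) (entry-φ a₂))))

    inclusionFree : δ ≤ Δ → (∀ a b → Escapes a b) → InclusionFree c
    inclusionFree δ≤Δ esc = proper , palettes-incomparable
      where
      palettes-incomparable : ∀ u v → KAdj u v →
        ¬ (Palette c u ⊆P Palette c v) × ¬ (Palette c v ⊆P Palette c u)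
      palettes-incomparable (inj₁ a) (inj₂ b) _ = row⊈column (esc a b) , column⊈row δ≤Δ (esc a b)
      palettes-incomparable (inj₂ b) (inj₁ a) _ = column⊈row δ≤Δ (esc a b) , row⊈column (esc a b)

module _ {Δ d m : ℕ} (c : EdgeColouring (K Δ (suc d)) (Fin m)) (proper : Proper c)
         (esc : ∀ a b → Escapes c a b) where

  escapeColumn : Fin Δ → Fin d
  escapeColumn a with esc a zero
  ... | zero , fresh = ⊥-elim (fresh (a , refl))
  ... | suc j , _ = j

  escapeColumn-fresh : ∀ a a′ → entry c a′ zero ≢ entry c a (suc (escapeColumn a))
  escapeColumn-fresh a a′ with esc a zero
  ... | zero , fresh = ⊥-elim (fresh (a , refl))
  ... | suc j , fresh = λ eq → fresh (a′ , eq)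

  labelledColour : Fin Δ ⊎ Fin d × Fin Δ → Fin d × Fin m
  labelledColour (inj₁ a) = escapeColumn a , entry c a (suc (escapeColumn a))
  labelledColour (inj₂ (j , a)) = j , entry c a zero

  labelledColour-injective : Injective _≡_ _≡_ labelledColour
  labelledColour-injective {inj₁ a₁} {inj₁ a₂} eq =
    cong inj₁ (entry-injectiveˡ c proper (suc (escapeColumn a₁))
      (trans (,-injectiveʳ eq) (cong (λ j → entry c a₂ (suc j)) (sym (,-injectiveˡ eq)))))
  labelledColour-injective {inj₁ a₁} {inj₂ (_ , a₂)} eq =
    ⊥-elim (escapeColumn-fresh a₁ a₂ (sym (,-injectiveʳ eq)))
  labelledColour-injective {inj₂ (_ , a₁)} {inj₁ a₂} eq =
    ⊥-elim (escapeColumn-fresh a₂ a₁ (,-injectiveʳ eq))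
  labelledColour-injective {inj₂ (j , a₁)} {inj₂ (_ , a₂)} eq with refl ← ,-injectiveˡ eq =
    cong (λ a → inj₂ (j , a)) (entry-injectiveˡ c proper zero (,-injectiveʳ eq))

  [1+d]*Δ≤d*m : suc d * Δ ≤ d * m
  [1+d]*Δ≤d*m = injective⇒≤ (Injection.injective counting)
    where
    counting : Fin (Δ + d * Δ) ↣ Fin (d * m)
    counting = ↔⇒↣ (↔-sym *↔×) ↣-∘
               (mk↣ labelledColour-injective ↣-∘ (↔⇒↣ (↔-refl ⊎-↔ *↔×) ↣-∘ ↔⇒↣ +↔⊎))

n≤m*o⇒⌈n/o⌉≤m : ∀ {n m} o → n ≤ m * suc o → ⌈ n / suc o ⌉ ≤ m
n≤m*o⇒⌈n/o⌉≤m {n} {m} o n≤m*o = s≤s⁻¹ (m<n*o⇒m/o<n (begin-strict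
  n + o              <⟨ +-monoʳ-< n (n<1+n o) ⟩
  n + suc o          ≤⟨ +-monoˡ-≤ (suc o) n≤m*o ⟩
  m * suc o + suc o  ≡⟨ +-comm (m * suc o) (suc o) ⟩
  suc m * suc o      ∎))
  where open ≤-Reasoning

bound≤colours : ∀ {Δ e m} (c : EdgeColouring (K Δ (suc (suc e))) (Fin m)) →
  InclusionFree c → bound Δ (suc (suc e)) ≤ m
bound≤colours {Δ} {e} {m} c inclFree@(proper , _) = n≤m*o⇒⌈n/o⌉≤m e (begin
  suc (suc e) * Δ   ≤⟨ [1+d]*Δ≤d*m c proper (escapes c inclFree) ⟩
  suc e * m         ≡⟨ *-comm (suc e) m ⟩
  m * suc e         ∎)
  where open ≤-Reasoning

fromMatrix : ∀ {Δ δ n} → (Fin Δ → Fin δ → Fin (suc n)) → EdgeColouring (K Δ δ) (Fin (suc n))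
fromMatrix {Δ} {δ} {n} M = record { col = colour ; col-sym = colour-sym }
  where
  colour : Fin Δ ⊎ Fin δ → Fin Δ ⊎ Fin δ → Fin (suc n)
  colour (inj₁ a) (inj₂ b) = M a b
  colour (inj₂ b) (inj₁ a) = M a b
  colour (inj₁ _) (inj₁ _) = zero
  colour (inj₂ _) (inj₂ _) = zero

  colour-sym : ∀ {u v} → KAdj u v → colour u v ≡ colour v u
  colour-sym {inj₁ _} {inj₂ _} _ = refl
  colour-sym {inj₂ _} {inj₁ _} _ = refl

fromMatrix-proper : ∀ {Δ δ n} (M : Fin Δ → Fin δ → Fin (suc n)) →
  (∀ b → Injective _≡_ _≡_ (λ a → M a b)) → (∀ a → Injective _≡_ _≡_ (M a)) →
  Proper (fromMatrix M)
fromMatrix-proper M injˡ injʳ (inj₁ a) (inj₂ _) (inj₂ _) _ _ eq = cong inj₂ (injʳ a eq)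
fromMatrix-proper M injˡ injʳ (inj₂ b) (inj₁ _) (inj₁ _) _ _ eq = cong inj₁ (injˡ b eq)

[m%n+o]%n≡[m+o]%n : ∀ m o n .{{_ : NonZero n}} → (m % n + o) % n ≡ (m + o) % n
[m%n+o]%n≡[m+o]%n m o n = begin
  (m % n + o) % n              ≡⟨ [m+kn]%n≡m%n (m % n + o) (m / n) n ⟨
  (m % n + o + m / n * n) % n  ≡⟨ cong (_% n) (+-comm-middle (m % n) o (m / n * n)) ⟩
  (m % n + m / n * n + o) % n  ≡⟨ cong (λ x → (x + o) % n) (m≡m%n+[m/n]*n m n) ⟨
  (m + o) % n                  ∎
  where
  open ≡-Reasoning
  +-comm-middle : ∀ x y z → x + y + z ≡ x + z + y
  +-comm-middle x y z = trans (+-assoc x y z) (trans (cong (x +_) (+-comm y z)) (sym (+-assoc x z y)))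

-- Adding n ∸ o % n undoes adding o modulo n.
%-cancelʳ-+ : ∀ {m p o n} .{{_ : NonZero n}} → m < n → p < n → (m + o) % n ≡ (p + o) % n → m ≡ p
%-cancelʳ-+ {m} {p} {o} {n} m<n p<n eq = begin
  m                           ≡⟨ undo m<n ⟩
  ((m + o) % n + o′) % n      ≡⟨ cong (λ x → (x + o′) % n) eq ⟩
  ((p + o) % n + o′) % n      ≡⟨ undo p<n ⟨
  p                           ∎
  where
  open ≡-Reasoning
  o′ : ℕ
  o′ = n ∸ o % n

  o+o′≡ : o + o′ ≡ suc (o / n) * n
  o+o′≡ = begin
    o + o′                          ≡⟨ cong (_+ o′) (trans (m≡m%n+[m/n]*n o n) (+-comm (o % n) _)) ⟩
    o / n * n + o % n + o′          ≡⟨ +-assoc (o / n * n) (o % n) o′ ⟩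
    o / n * n + (o % n + o′)        ≡⟨ cong (o / n * n +_) (m+[n∸m]≡n (m%n≤n o n)) ⟩
    o / n * n + n                   ≡⟨ +-comm (o / n * n) n ⟩
    suc (o / n) * n                 ∎

  undo : ∀ {x} → x < n → x ≡ ((x + o) % n + o′) % n
  undo {x} x<n = begin
    x                         ≡⟨ m<n⇒m%n≡m x<n ⟨
    x % n                     ≡⟨ [m+kn]%n≡m%n x (suc (o / n)) n ⟨
    (x + suc (o / n) * n) % n ≡⟨ cong (λ y → (x + y) % n) o+o′≡ ⟨
    (x + (o + o′)) % n        ≡⟨ cong (_% n) (+-assoc x o o′) ⟨
    (x + o + o′) % n          ≡⟨ [m%n+o]%n≡[m+o]%n (x + o) o′ n ⟨
    ((x + o) % n + o′) % n    ∎

module Construction (e D : ℕ) (δ≤Δ : suc (suc e) ≤ suc D) where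

  private
    d δ Δ : ℕ
    d = suc e
    δ = suc d
    Δ = suc D

  offset : ℕ → ℕ
  offset a = a + a / d

  offset≡ : ∀ a → offset a ≡ a % d + a / d * δ
  offset≡ a = begin
    a + a / d                      ≡⟨ cong (_+ a / d) (m≡m%n+[m/n]*n a d) ⟩
    a % d + a / d * d + a / d      ≡⟨ +-assoc (a % d) (a / d * d) (a / d) ⟩
    a % d + (a / d * d + a / d)    ≡⟨ cong (a % d +_) (+-comm (a / d * d) (a / d)) ⟩
    a % d + (a / d + a / d * d)    ≡⟨ cong (a % d +_) (*-suc (a / d) d) ⟨
    a % d + a / d * δ              ∎
    where open ≡-Reasoning

  offset%δ : ∀ a → offset a % δ ≡ a % d
  offset%δ a = begin
    offset a % δ                   ≡⟨ cong (_% δ) (offset≡ a) ⟩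
    (a % d + a / d * δ) % δ        ≡⟨ [m+kn]%n≡m%n (a % d) (a / d) δ ⟩
    a % d % δ                      ≡⟨ m<n⇒m%n≡m (m<n⇒m<1+n (m%n<n a d)) ⟩
    a % d                          ∎
    where open ≡-Reasoning

  offset-mono-≤ : ∀ {a b} → a ≤ b → offset a ≤ offset b
  offset-mono-≤ a≤b = +-mono-≤ a≤b (/-monoˡ-≤ d a≤b)

  offset-mono-< : ∀ {a b} → a < b → offset a < offset b
  offset-mono-< a<b = +-mono-<-≤ a<b (/-monoˡ-≤ d (<⇒≤ a<b))

  offset-injective : Injective _≡_ _≡_ offset
  offset-injective eq = ≤-antisym
    (≮⇒≥ λ b<a → <⇒≢ (offset-mono-< b<a) (sym eq))
    (≮⇒≥ λ a<b → <⇒≢ (offset-mono-< a<b) eq)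

  k : ℕ
  k = suc (suc (offset D))

  offset<k : ∀ (a : Fin Δ) → offset (toℕ a) < k
  offset<k a = s≤s (m≤n⇒m≤1+n (offset-mono-≤ (s≤s⁻¹ (toℕ<n a))))

  δ<k : δ < k
  δ<k = s≤s (≤-trans δ≤Δ (s≤s (m≤m+n D (D / d))))

  FreeSlot : ℕ → Set
  FreeSlot z = ∀ (a : Fin Δ) → offset (toℕ a) ≢ z

  gap-free : ∀ t → FreeSlot (t * δ + d)
  gap-free t a eq = <⇒≢ (m%n<n (toℕ a) d) (begin
    toℕ a % d                      ≡⟨ offset%δ (toℕ a) ⟨
    offset (toℕ a) % δ             ≡⟨ cong (_% δ) eq ⟩
    (t * δ + d) % δ                ≡⟨ cong (_% δ) (+-comm (t * δ) d) ⟩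
    (d + t * δ) % δ                ≡⟨ [m+kn]%n≡m%n d t δ ⟩
    d % δ                          ≡⟨ m<n⇒m%n≡m (n<1+n d) ⟩
    d                              ∎)
    where open ≡-Reasoning

  top-free : FreeSlot (suc (offset D))
  top-free a = <⇒≢ (s≤s (offset-mono-≤ (s≤s⁻¹ (toℕ<n a))))

  -- Some t * δ + d lies in [r, r + d]; if it is not below k, then the top slot k ∸ 1 is.
  freeSlot-window : ∀ r → r < k → ∃[ j ] j < δ × r + j < k × FreeSlot (r + j)
  freeSlot-window r r<k with r / δ * δ + d <? k
  ... | yes gap<k = d ∸ r % δ , s≤s (m∸n≤m d (r % δ)) ,
                    subst (_< k) (sym r+j≡gap) gap<k , subst FreeSlot (sym r+j≡gap) (gap-free (r / δ))
    where
    open ≡-Reasoning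
    r+j≡gap : r + (d ∸ r % δ) ≡ r / δ * δ + d
    r+j≡gap = begin
      r + (d ∸ r % δ)                    ≡⟨ cong (_+ (d ∸ r % δ)) (m≡m%n+[m/n]*n r δ) ⟩
      r % δ + r / δ * δ + (d ∸ r % δ)    ≡⟨ cong (_+ (d ∸ r % δ)) (+-comm (r % δ) (r / δ * δ)) ⟩
      r / δ * δ + r % δ + (d ∸ r % δ)    ≡⟨ +-assoc (r / δ * δ) (r % δ) (d ∸ r % δ) ⟩
      r / δ * δ + (r % δ + (d ∸ r % δ))  ≡⟨ cong (r / δ * δ +_) (m+[n∸m]≡n (s≤s⁻¹ (m%n<n r δ))) ⟩
      r / δ * δ + d                      ∎
  ... | no gap≮k = suc (offset D) ∸ r , s≤s j≤d , subst (_< k) (sym r+j≡top) (n<1+n _) ,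
                   subst FreeSlot (sym r+j≡top) top-free
    where
    open ≤-Reasoning
    r+j≡top : r + (suc (offset D) ∸ r) ≡ suc (offset D)
    r+j≡top = m+[n∸m]≡n (s≤s⁻¹ r<k)
    j≤d : suc (offset D) ∸ r ≤ d
    j≤d = m≤n+o⇒m∸n≤o (suc (offset D)) r (begin
      suc (offset D)        ≤⟨ n≤1+n _ ⟩
      k                     ≤⟨ ≮⇒≥ gap≮k ⟩
      r / δ * δ + d         ≤⟨ +-monoˡ-≤ d (m≤n+m (r / δ * δ) (r % δ)) ⟩
      r % δ + r / δ * δ + d ≡⟨ cong (_+ d) (m≡m%n+[m/n]*n r δ) ⟨
      r + d                 ∎)

  colour : Fin Δ → Fin δ → Fin k
  colour a b = (offset (toℕ a) + toℕ b) mod k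

  colour-≡ : ∀ {a₁ a₂ b₁ b₂} → colour a₁ b₁ ≡ colour a₂ b₂ →
    (offset (toℕ a₁) + toℕ b₁) % k ≡ (offset (toℕ a₂) + toℕ b₂) % k
  colour-≡ eq = trans (sym (toℕ-fromℕ< _)) (trans (cong toℕ eq) (toℕ-fromℕ< _))

  colour-injectiveˡ : ∀ b → Injective _≡_ _≡_ (λ a → colour a b)
  colour-injectiveˡ b {a₁} {a₂} eq =
    toℕ-injective (offset-injective
      (%-cancelʳ-+ (offset<k a₁) (offset<k a₂) (colour-≡ {a₁} {a₂} {b} {b} eq)))

  colour-injectiveʳ : ∀ a → Injective _≡_ _≡_ (colour a)
  colour-injectiveʳ a {b₁} {b₂} eq = toℕ-injective (%-cancelʳ-+ (b<k b₁) (b<k b₂)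
    (trans (cong (_% k) (+-comm (toℕ b₁) x))
      (trans (colour-≡ {a} {a} {b₁} {b₂} eq) (cong (_% k) (+-comm x (toℕ b₂))))))
    where
    x : ℕ
    x = offset (toℕ a)
    b<k : ∀ (b : Fin δ) → toℕ b < k
    b<k b = <-trans (toℕ<n b) δ<k

  colour-escapes : ∀ a b → Escapes (fromMatrix colour) a b
  colour-escapes a b
    with freeSlot-window ((offset (toℕ a) + (k ∸ toℕ b)) % k) (m%n<n (offset (toℕ a) + (k ∸ toℕ b)) k)
  ... | j , j<δ , r+j<k , free = fromℕ< j<δ , λ (a′ , eq) →
    free a′ (%-cancelʳ-+ (offset<k a′) r+j<k (begin
      (offset (toℕ a′) + toℕ b) % k   ≡⟨ colour-≡ {a′} {a} {b} eq ⟩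
      (x + toℕ (fromℕ< j<δ)) % k       ≡⟨ cong (λ z → (x + z) % k) (toℕ-fromℕ< j<δ) ⟩
      (x + j) % k                      ≡⟨ [m+n]%n≡m%n (x + j) k ⟨
      (x + j + k) % k                  ≡⟨ cong (_% k) unshift ⟨
      (y + (j + toℕ b)) % k            ≡⟨ [m%n+o]%n≡[m+o]%n y (j + toℕ b) k ⟨
      (y % k + (j + toℕ b)) % k        ≡⟨ cong (_% k) (+-assoc (y % k) j (toℕ b)) ⟨
      (y % k + j + toℕ b) % k          ∎))
    where
    open ≡-Reasoning
    x y : ℕ
    x = offset (toℕ a)
    y = x + (k ∸ toℕ b)
    regroup : ∀ x s j b → x + s + (j + b) ≡ x + j + (s + b)
    regroup = solve-∀
    unshift : y + (j + toℕ b) ≡ x + j + k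
    unshift = trans (regroup x (k ∸ toℕ b) j (toℕ b))
      (cong (x + j +_) (m∸n+n≡m (<⇒≤ (<-trans (toℕ<n b) δ<k))))

  colourable : InclusionColourable (K Δ δ) k
  colourable = fromMatrix colour ,
    inclusionFree (fromMatrix colour) (fromMatrix-proper colour colour-injectiveˡ colour-injectiveʳ)
      δ≤Δ colour-escapes

  bound≡k : bound Δ δ ≡ k
  bound≡k = begin
    (δ * Δ + e) / d              ≡⟨ cong (_/ d) (regroup e D) ⟩
    (D + d + Δ * d) / d          ≡⟨ +-distrib-/-∣ʳ (D + d) (divides-refl Δ) ⟩
    (D + d) / d + Δ * d / d      ≡⟨ cong₂ _+_ (+-distrib-/-∣ʳ D ∣-refl) (m*n/n≡m Δ d) ⟩
    D / d + d / d + Δ            ≡⟨ cong (λ q → D / d + q + Δ) (n/n≡1 d) ⟩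
    D / d + 1 + suc D            ≡⟨ tidy (D / d) D ⟩
    k                            ∎
    where
    open ≡-Reasoning
    regroup : ∀ e D → suc (suc e) * suc D + e ≡ D + suc e + suc D * suc e
    regroup = solve-∀
    tidy : ∀ q D → q + 1 + suc D ≡ suc (suc (D + q))
    tidy = solve-∀

proposition1 : (Δ δ : ℕ) → 2 ≤ δ → δ ≤ Δ →
    InclusionChromaticIndex (K Δ δ) (bound Δ δ)
proposition1 (suc D) (suc (suc e)) (s≤s (s≤s z≤n)) δ≤Δ =
  subst (InclusionColourable (K (suc D) (suc (suc e)))) (sym bound≡k) colourable ,
  λ m (c , inclFree) → bound≤colours c inclFree
  where open Construction e D δ≤Δ
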